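{- Let $A$ be a finite algebra and let $(a,b,c,d)$ be an induced $4$-vertex path in the power graph of $A$ (so $a\sim b$, $b\sim c$, $c\sim d$ are the only adjacencies among $a,b,c,d$). Then one of the pairs $\{a,c\}$ and $\{b,d\}$ is an edge of the enhanced power graph of $A$, and the other is an edge of the intersection power graph of $A$.
   Context: An algebra is a set $A$ with a collection of operations of various finite arities (nullary operations give constants). For $S\subseteq A$, $\langle S\rangle$ is the subalgebra generated by $S$; $\langle x\rangle=\langle\{x\}\rangle$. $E(A)=\langle\emptyset\rangle$ is the smallest subalgebra (possibly empty). Graphs are simple with vertex set $A$. Power graph: distinct $x,y$ adjacent iff $x\in\langle y\rangle$ or $y\in\langle x\rangle$. Enhanced power graph: distinct $x,y$ adjacent iff there is $z\in A$ with $x,y\in\langle z\rangle$. Intersection power graph: distinct $x,y$ adjacent iff $x\in E(A)$ or $y\in E(A)$ or $\langle x\rangle\cap\langle y\rangle$ properly contains $E(A)$. -}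

module Defs where

open import Data.Nat using (ℕ)
open import Data.Fin using (Fin)
open import Data.Empty using (⊥)
open import Data.Sum using (_⊎_)
open import Data.Product using (_×_; ∃-syntax)
open import Relation.Nullary using (¬_)
open import Relation.Binary.PropositionalEquality using (_≡_; _≢_)
open import Function.Bundles using (_↔_)

record Algebra : Set₁ where
  field
    Carrier : Set
    Op      : Set
    arity   : Op → ℕ
    apply   : (o : Op) → (Fin (arity o) → Carrier) → Carrier

record FiniteAlgebra : Set₁ where
  field
    algebra : Algebra
    size    : ℕ
    finite  : Fin size ↔ Algebra.Carrier algebra
  open Algebra algebra public

module _ (A : Algebra) where
  open Algebra A

  data Gen (S : Carrier → Set) : Carrier → Set where
    base  : ∀ {x} → S x → Gen S x
    close : (o : Op) (xs : Fin (arity o) → Carrier) →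
            (∀ i → Gen S (xs i)) → Gen S (apply o xs)

  _∈⟨_⟩ : Carrier → Carrier → Set
  x ∈⟨ y ⟩ = Gen (λ z → z ≡ y) x

  InE : Carrier → Set
  InE x = Gen (λ _ → ⊥) x

  PowerAdj : Carrier → Carrier → Set
  PowerAdj x y = x ≢ y × (x ∈⟨ y ⟩ ⊎ y ∈⟨ x ⟩)

  EnhancedAdj : Carrier → Carrier → Set
  EnhancedAdj x y = x ≢ y × ∃[ z ] (x ∈⟨ z ⟩ × y ∈⟨ z ⟩)

  ProperlyContainsE : Carrier → Carrier → Set
  ProperlyContainsE x y =
    (∀ w → InE w → w ∈⟨ x ⟩ × w ∈⟨ y ⟩) ×
    ∃[ w ] ((w ∈⟨ x ⟩ × w ∈⟨ y ⟩) × ¬ InE w)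

  IntersectionAdj : Carrier → Carrier → Set
  IntersectionAdj x y = x ≢ y × (InE x ⊎ InE y ⊎ ProperlyContainsE x y)

  InducedP4 : Carrier → Carrier → Carrier → Carrier → Set
  InducedP4 a b c d =
    (a ≢ c × a ≢ d × b ≢ d) ×
    (PowerAdj a b × PowerAdj b c × PowerAdj c d) ×
    (¬ PowerAdj a c × ¬ PowerAdj a d × ¬ PowerAdj b d)

-- Generation is transitive (x ∈ ⟨y⟩ and y ∈ ⟨z⟩ give x ∈ ⟨z⟩), so an induced
-- path in the power graph cannot contain two consecutive arcs in the same
-- direction, as the endpoints of such a pair would be adjacent. Hence the
-- path a - b - c - d alternates, and up to reversal a, c ∈ ⟨b⟩ and c ∈ ⟨d⟩.
-- Then b witnesses that a and c are adjacent in the enhanced power graph, and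
-- c ∈ ⟨b⟩ ∩ ⟨d⟩ lies outside E(A), since E(A) ⊆ ⟨a⟩ and c ∉ ⟨a⟩.
module Submission where

open import Defs
open import Data.Sum using (_⊎_; inj₁; inj₂)
open import Data.Product using (_×_; _,_; proj₁; proj₂)
open import Data.Empty using (⊥-elim)
open import Relation.Nullary using (¬_)
open import Relation.Binary.PropositionalEquality using (refl; _≢_)

module _ (A : Algebra) where
  ∈⟨⟩-trans : ∀ {x y z} → _∈⟨_⟩ A x y → _∈⟨_⟩ A y z → _∈⟨_⟩ A x z
  ∈⟨⟩-trans (base refl)    y∈z = y∈z
  ∈⟨⟩-trans (close o xs f) y∈z = close o xs (λ i → ∈⟨⟩-trans (f i) y∈z)

  InE⇒∈⟨⟩ : ∀ {w x} → InE A w → _∈⟨_⟩ A w x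
  InE⇒∈⟨⟩ (base ())
  InE⇒∈⟨⟩ (close o xs f) = close o xs (λ i → InE⇒∈⟨⟩ (f i))

  ¬PowerAdj⇒¬InE : ∀ {x y} → x ≢ y → ¬ PowerAdj A x y → ¬ InE A x × ¬ InE A y
  ¬PowerAdj⇒¬InE x≢y ¬x~y =
    (λ x∈E → ¬x~y (x≢y , inj₁ (InE⇒∈⟨⟩ x∈E))) ,
    (λ y∈E → ¬x~y (x≢y , inj₂ (InE⇒∈⟨⟩ y∈E)))

  commonGenerator⇒EnhancedAdj : ∀ {x y z} → x ≢ y →
    _∈⟨_⟩ A x z → _∈⟨_⟩ A y z → EnhancedAdj A x y
  commonGenerator⇒EnhancedAdj {z = z} x≢y x∈z y∈z = x≢y , z , x∈z , y∈z

  commonElement⇒IntersectionAdj : ∀ {x y w} → x ≢ y →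
    _∈⟨_⟩ A w x → _∈⟨_⟩ A w y → ¬ InE A w → IntersectionAdj A x y
  commonElement⇒IntersectionAdj {w = w} x≢y w∈x w∈y w∉E =
    x≢y , inj₂ (inj₂ ((λ _ v∈E → InE⇒∈⟨⟩ v∈E , InE⇒∈⟨⟩ v∈E) , w , (w∈x , w∈y) , w∉E))

  InducedP4-alternates : ∀ {a b c d} → InducedP4 A a b c d →
    (_∈⟨_⟩ A a b × _∈⟨_⟩ A c b × _∈⟨_⟩ A c d) ⊎
    (_∈⟨_⟩ A b a × _∈⟨_⟩ A b c × _∈⟨_⟩ A d c)
  InducedP4-alternates ((a≢c , _ , b≢d) , ((_ , ab) , (_ , bc) , (_ , cd)) , (¬a~c , _ , ¬b~d))
    with ab | bc | cd
  ... | inj₁ a∈b | inj₁ b∈c | _        = ⊥-elim (¬a~c (a≢c , inj₁ (∈⟨⟩-trans a∈b b∈c)))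
  ... | inj₂ b∈a | inj₂ c∈b | _        = ⊥-elim (¬a~c (a≢c , inj₂ (∈⟨⟩-trans c∈b b∈a)))
  ... | inj₁ _   | inj₂ c∈b | inj₂ d∈c = ⊥-elim (¬b~d (b≢d , inj₂ (∈⟨⟩-trans d∈c c∈b)))
  ... | inj₂ _   | inj₁ b∈c | inj₁ c∈d = ⊥-elim (¬b~d (b≢d , inj₁ (∈⟨⟩-trans b∈c c∈d)))
  ... | inj₁ a∈b | inj₂ c∈b | inj₁ c∈d = inj₁ (a∈b , c∈b , c∈d)
  ... | inj₂ b∈a | inj₁ b∈c | inj₂ d∈c = inj₂ (b∈a , b∈c , d∈c)

  InducedP4⇒EnhancedAdj×IntersectionAdj : ∀ {a b c d} → InducedP4 A a b c d →
    (EnhancedAdj A a c × IntersectionAdj A b d) ⊎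
    (EnhancedAdj A b d × IntersectionAdj A a c)
  InducedP4⇒EnhancedAdj×IntersectionAdj p4@((a≢c , _ , b≢d) , _ , (¬a~c , _ , ¬b~d))
    with InducedP4-alternates p4
  ... | inj₁ (a∈b , c∈b , c∈d) =
    inj₁ ( commonGenerator⇒EnhancedAdj a≢c a∈b c∈b
         , commonElement⇒IntersectionAdj b≢d c∈b c∈d (proj₂ (¬PowerAdj⇒¬InE a≢c ¬a~c)))
  ... | inj₂ (b∈a , b∈c , d∈c) =
    inj₂ ( commonGenerator⇒EnhancedAdj b≢d b∈c d∈c
         , commonElement⇒IntersectionAdj a≢c b∈a b∈c (proj₁ (¬PowerAdj⇒¬InE b≢d ¬b~d)))

mainTheorem3 : (A : FiniteAlgebra) →
    let alg = FiniteAlgebra.algebra A in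
    (a b c d : FiniteAlgebra.Carrier A) →
    InducedP4 alg a b c d →
    (EnhancedAdj alg a c × IntersectionAdj alg b d) ⊎
    (EnhancedAdj alg b d × IntersectionAdj alg a c)
mainTheorem3 A _ _ _ _ = InducedP4⇒EnhancedAdj×IntersectionAdj (FiniteAlgebra.algebra A)
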